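{- For every $n\ge1$, $$|\mathcal{CS}_{\mathfrak{A}_{\mathcal{P}_n}}|\ \ge\ \sum_{(i,j,k)\in\mathrm{LCM}_n}|\mathcal{CS}_{n,i}|\cdot|\mathcal{CS}_{n,j}|\cdot|\mathcal{CS}_{n,k}|.$$
   Context: A partial Latin square of order $n$ is an $n\times n$ array whose cells are empty or contain a symbol of $[n]$, each symbol at most once per row and column; non-empty means some cell is filled. For $\Theta=(\alpha,\beta,\gamma)\in S_n^3$, $\Theta$ is an autotopism of $P$ if $\{(\alpha(r),\beta(c),\gamma(s)):(r,c,s)\in O(P)\}=O(P)$, where $O(P)$ is the set of triples (row, column, symbol) of filled cells. The cycle structure of $\Theta$ is the triple of cycle structures (numbers of cycles of each length, fixed points included) of $\alpha,\beta,\gamma$. $\mathcal{CS}_{\mathfrak{A}_{\mathcal{P}_n}}$ is the set of cycle structures of isotopisms $\Theta\in S_n^3$ that are autotopisms of at least one non-empty partial Latin square of order $n$. $\mathcal{CS}_n$ is the set of cycle structures of $S_n$ and, for $m\in[n]$, $\mathcal{CS}_{n,m}$ is the set of those whose shortest cycle has length exactly $m$. $\mathrm{LCM}_n=\{(i,j,k)\in[n]^3:\mathrm{lcm}(i,j)=\mathrm{lcm}(i,k)=\mathrm{lcm}(j,k)=\mathrm{lcm}(i,j,k)\}$. -}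

module Defs where

open import Data.Nat using (ℕ; zero; suc; _+_; _*_; _≡ᵇ_; _/_; _≤_)
open import Data.Nat.LCM using (lcm)
open import Data.Bool using (Bool; true; false; _∧_; if_then_else_; not)
open import Data.Fin using (Fin; toℕ; _≟_)
open import Data.Fin.Permutation using (Permutation′; _⟨$⟩ʳ_)
open import Data.Vec using (Vec; []; _∷_; tabulate)
open import Data.List using (List; []; _∷_; length; filterᵇ; map; upTo; concatMap; allFin)
open import Data.List.Membership.Propositional using (_∈_)
open import Data.List.Relation.Unary.All using (All)
open import Data.List.Relation.Unary.Unique.Propositional using (Unique)
open import Data.Nat.ListAction using (sum)
open import Data.Maybe using (Maybe; just; nothing)
open import Data.Product using (Σ; ∃; _×_; _,_)
open import Relation.Binary.PropositionalEquality using (_≡_)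
open import Relation.Nullary.Decidable using (⌊_⌋)

-- A cycle structure of S_n is represented as a vector v : Vec ℕ n whose
-- entry at position ℓ (ℓ : Fin n) is the number of cycles of length
-- toℕ ℓ + 1 (fixed points included at position 0).

iter : ∀ {n} → Permutation′ n → ℕ → Fin n → Fin n
iter π zero    x = x
iter π (suc k) x = π ⟨$⟩ʳ (iter π k x)

-- length of the cycle of π through x: the least k ≥ 1 with π^k x = x
-- (searched among k = 1 … n, which always contains it).
orbitLen : ∀ {n} → Permutation′ n → Fin n → ℕ
orbitLen {n} π x = go n 1
  where
  go : ℕ → ℕ → ℕ
  go zero    k = k
  go (suc f) k = if ⌊ iter π k x ≟ x ⌋ then k else go f (suc k)

pointsOnCyclesOfLength : ∀ {n} → Permutation′ n → ℕ → ℕ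
pointsOnCyclesOfLength {n} π L = length (filterᵇ (λ x → orbitLen π x ≡ᵇ L) (allFin n))

cycleStructure : ∀ {n} → Permutation′ n → Vec ℕ n
cycleStructure {n} π =
  tabulate (λ ℓ → pointsOnCyclesOfLength π (suc (toℕ ℓ)) / suc (toℕ ℓ))

PLS : ℕ → Set
PLS n = Fin n → Fin n → Maybe (Fin n)

IsPartialLatinSquare : ∀ {n} → PLS n → Set
IsPartialLatinSquare {n} P =
  (∀ r c c′ s → P r c ≡ just s → P r c′ ≡ just s → c ≡ c′) ×
  (∀ r r′ c s → P r c ≡ just s → P r′ c ≡ just s → r ≡ r′)

NonEmpty : ∀ {n} → PLS n → Set
NonEmpty {n} P = Σ (Fin n) λ r → Σ (Fin n) λ c → Σ (Fin n) λ s → P r c ≡ just s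

IsAutotopism : ∀ {n} → Permutation′ n → Permutation′ n → Permutation′ n → PLS n → Set
IsAutotopism {n} α β γ P =
  (∀ r c s → P r c ≡ just s → P (α ⟨$⟩ʳ r) (β ⟨$⟩ʳ c) ≡ just (γ ⟨$⟩ʳ s)) ×
  (∀ r′ c′ s′ → P r′ c′ ≡ just s′ →
     Σ (Fin n) λ r → Σ (Fin n) λ c → Σ (Fin n) λ s →
       P r c ≡ just s × α ⟨$⟩ʳ r ≡ r′ × β ⟨$⟩ʳ c ≡ c′ × γ ⟨$⟩ʳ s ≡ s′)

CSTriple : ℕ → Set
CSTriple n = Vec ℕ n × Vec ℕ n × Vec ℕ n

InCSAutotopismsPLS : ∀ {n} → CSTriple n → Set
InCSAutotopismsPLS {n} (a , b , c) =
  Σ (Permutation′ n) λ α → Σ (Permutation′ n) λ β → Σ (Permutation′ n) λ γ →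
  Σ (PLS n) λ P →
    IsPartialLatinSquare P × NonEmpty P × IsAutotopism α β γ P ×
    cycleStructure α ≡ a × cycleStructure β ≡ b × cycleStructure γ ≡ c

CardCSAutotopismsPLS≥ : ℕ → ℕ → Set
CardCSAutotopismsPLS≥ n m =
  Σ (List (CSTriple n)) λ L → Unique L × All InCSAutotopismsPLS L × m ≤ length L

-- CS_n and CS_{n,m}.
-- The cycle structures of S_n are exactly the vectors v with
-- Σ_ℓ (ℓ+1)·v_ℓ = n (partitions of n); entries are then ≤ n.

weightFrom : ∀ {m} → ℕ → Vec ℕ m → ℕ
weightFrom k []      = 0
weightFrom k (x ∷ v) = k * x + weightFrom (suc k) v

weight : ∀ {m} → Vec ℕ m → ℕ
weight v = weightFrom 1 v

shortestFrom : ∀ {m} → ℕ → Vec ℕ m → ℕ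
shortestFrom k []      = 0
shortestFrom k (x ∷ v) = if x ≡ᵇ 0 then shortestFrom (suc k) v else k

shortest : ∀ {m} → Vec ℕ m → ℕ
shortest v = shortestFrom 1 v

vecsBounded : (m b : ℕ) → List (Vec ℕ m)
vecsBounded zero    b = [] ∷ []
vecsBounded (suc m) b = concatMap (λ x → map (x ∷_) (vecsBounded m b)) (upTo (suc b))

cardCS : (n m : ℕ) → ℕ
cardCS n m = length (filterᵇ (λ v → (weight v ≡ᵇ n) ∧ (shortest v ≡ᵇ m)) (vecsBounded n n))

inLCM : ℕ → ℕ → ℕ → Bool
inLCM i j k =
  let l = lcm (lcm i j) k in
  (lcm i j ≡ᵇ l) ∧ (lcm i k ≡ᵇ l) ∧ (lcm j k ≡ᵇ l)

range1 : ℕ → List ℕ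
range1 n = map suc (upTo n)

lcmSum : ℕ → ℕ
lcmSum n =
  sum (map (λ i → sum (map (λ j → sum (map (λ k →
    if inLCM i j k then cardCS n i * cardCS n j * cardCS n k else 0)
    (range1 n))) (range1 n))) (range1 n))

-- Fix (I, J, K) in LCM_n and cycle structures a, b, c of S_n whose shortest
-- cycles have lengths I, J, K.  Realise them by permutations α, β, γ of
-- {0, …, n-1} that are built block by block, the shortest cycle first, so
-- that α acts on {0, …, I-1} as t ↦ t + 1 mod I, and likewise β and γ.  The
-- cells (t mod I, t mod J, t mod K), t ∈ ℕ, then form a partial Latin square
-- with autotopism (α, β, γ), the shift t ↦ t + 1.  It is Latin because the
-- LCM condition says that each of I, J, K divides the lcm of the other two,
-- so two coordinates of a cell fix t modulo that lcm and hence the third.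
-- Triples from different (I, J, K) differ, since the shortest cycle lengths
-- can be read off the cycle structures.

module Submission where

open import Defs
open import Data.Bool using (Bool; true; false; T; if_then_else_; _∧_)
open import Data.Bool.Properties using (T?; T-∧)
open import Data.Fin as Fin using (Fin; toℕ; fromℕ<; _≟_)
open import Data.Fin.Permutation using (Permutation′; _⟨$⟩ʳ_; permutation)
open import Data.Fin.Properties using (toℕ-injective; toℕ<n; toℕ-fromℕ<; any?)
open import Data.List as List
  using (List; []; _∷_; _++_; length; filterᵇ; replicate; concatMap; cartesianProduct)
open import Data.List.Membership.Propositional using (_∈_)
open import Data.List.Membership.Propositional.Properties
  using (∈-filter⁻; ∈-map⁻; ∈-cartesianProduct⁻)
open import Data.List.Properties using (length-++; length-map; map-cong)
open import Data.List.Relation.Binary.Disjoint.Propositional using (Disjoint)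
open import Data.List.Relation.Unary.All as All using (All)
import Data.List.Relation.Unary.All.Properties as All
open import Data.List.Relation.Unary.AllPairs as AllPairs using ()
import Data.List.Relation.Unary.AllPairs.Properties as AllPairs
open import Data.List.Relation.Unary.Unique.Propositional using (Unique)
import Data.List.Relation.Unary.Unique.Propositional.Properties as Unique
open import Data.Maybe using (Maybe; just; nothing)
open import Data.Nat hiding (_≟_)
open import Data.Nat.DivMod
open import Data.Nat.Divisibility using (_∣_; divides; ∣-trans; ∣⇒≤; m∣m*n; n∣m*n; n∣m*n*o)
open import Data.Nat.GeneralisedArithmetic using (fold)
open import Data.Nat.LCM using (lcm; lcm-least; m∣lcm[m,n]; n∣lcm[m,n])
open import Data.Nat.ListAction using (sum)
open import Data.Nat.Properties hiding (_≟_)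
open import Data.Product using (∃; _×_; _,_; proj₁; proj₂)
open import Data.Sum using (inj₁; inj₂)
open import Data.Unit using (⊤; tt)
open import Data.Vec as Vec using (Vec; []; _∷_)
import Data.Vec.Properties as Vec
open import Function using (_∋_; _∘_; id; Equivalence)
open import Relation.Binary.PropositionalEquality
open import Relation.Nullary using (Dec; yes; no; contradiction; _×-dec_)
open import Relation.Nullary.Decidable using (⌊_⌋)

-- Exact periods and orbit lengths

record ExactPeriod {A : Set} (f : A → A) (x : A) (L : ℕ) : Set where
  field
    positive : 1 ≤ L
    returns  : fold x f L ≡ x
    minimal  : ∀ {j} → 1 ≤ j → j < L → fold x f j ≢ x

iter≡fold : ∀ {n} (π : Permutation′ n) k x → iter π k x ≡ fold x (π ⟨$⟩ʳ_) k
iter≡fold π zero    x = refl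
iter≡fold π (suc k) x = cong (π ⟨$⟩ʳ_) (iter≡fold π k x)

-- orbitLen uses an anonymous local function: orbitSearch π x f k returns the
-- least j ∈ [k, k + f) with iter π j x ≡ x, or k + f if there is none.  It is
-- named by unification: after orbitLen is unfolded one step, abstracting suc f
-- and 2 leaves it applied to variables only, and the ascription solves the meta.
mutual
  orbitSearch : ∀ {n} → Permutation′ n → Fin n → ℕ → ℕ → ℕ
  orbitSearch = _

  private
    orbitSearch-solution : ∀ {f} (π : Permutation′ (suc f)) x → orbitLen π x ≡ orbitLen π x → ⊤
    orbitSearch-solution {f} π x
      rewrite (orbitLen π x ≡ (if ⌊ iter π 1 x ≟ x ⌋ then 1 else _)) ∋ refl
      with suc f | 2
    ... | _ | k = λ (_ : (if ⌊ iter π 1 x ≟ x ⌋ then 1 else orbitSearch π x f k) ≡ _) → tt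

orbitSearch-exact : ∀ {n} (π : Permutation′ n) {x L} → ExactPeriod (π ⟨$⟩ʳ_) x L →
                    ∀ f k → 1 ≤ k → k ≤ L → L ≤ k + f → orbitSearch π x f k ≡ L
orbitSearch-exact π p zero    k 1≤k k≤L L≤k+0 = ≤-antisym k≤L (subst (_ ≤_) (+-identityʳ k) L≤k+0)
orbitSearch-exact π {x} p (suc f) k 1≤k k≤L L≤k+f
  with iter π k x ≟ x | m≤n⇒m<n∨m≡n k≤L
... | yes _     | inj₂ k≡L = k≡L
... | yes πᵏx≡x | inj₁ k<L =
  contradiction (trans (sym (iter≡fold π k x)) πᵏx≡x) (ExactPeriod.minimal p 1≤k k<L)
... | no πᵏx≢x  | inj₂ refl = contradiction (trans (iter≡fold π k x) (ExactPeriod.returns p)) πᵏx≢x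
... | no _      | inj₁ k<L =
  orbitSearch-exact π p f (suc k) (m≤n⇒m≤1+n 1≤k) k<L (≤-trans L≤k+f (≤-reflexive (+-suc k f)))

orbitLen-exact : ∀ {n} (π : Permutation′ n) {x L} → ExactPeriod (π ⟨$⟩ʳ_) x L → L ≤ n →
                 orbitLen π x ≡ L
orbitLen-exact {n} π p L≤n = orbitSearch-exact π p n 1 ≤-refl (ExactPeriod.positive p) (m≤n⇒m≤1+n L≤n)

exactPeriod-toℕ : ∀ {n} {π : Fin n → Fin n} {f : ℕ → ℕ} → (∀ x → toℕ (π x) ≡ f (toℕ x)) →
                  ∀ {x L} → ExactPeriod f (toℕ x) L → ExactPeriod π x L
exactPeriod-toℕ {π = π} {f} toℕ-π {x} {L} p = record
  { positive = positive
  ; returns  = toℕ-injective (trans (toℕ-fold L) returns)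
  ; minimal  = λ {j} 1≤j j<L πʲx≡x → minimal 1≤j j<L (trans (sym (toℕ-fold j)) (cong toℕ πʲx≡x))
  }
  where
  open ExactPeriod p
  toℕ-fold : ∀ j → toℕ (fold x π j) ≡ fold (toℕ x) f j
  toℕ-fold zero    = refl
  toℕ-fold (suc j) = trans (toℕ-π (fold x π j)) (cong f (toℕ-fold j))

-- Permutations assembled from functions on ℕ

ClosedBelow : ℕ → (ℕ → ℕ) → Set
ClosedBelow m f = ∀ {x} → x < m → f x < m

InverseBelow : ℕ → (ℕ → ℕ) → (ℕ → ℕ) → Set
InverseBelow m f g = ∀ {x} → x < m → f (g x) ≡ x

module _ {n} {f g : ℕ → ℕ} (f-closed : ClosedBelow n f) (g-closed : ClosedBelow n g)
         (f∘g≡id : InverseBelow n f g) (g∘f≡id : InverseBelow n g f) where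

  private
    lift : {h : ℕ → ℕ} → ClosedBelow n h → Fin n → Fin n
    lift h-closed x = fromℕ< (h-closed (toℕ<n x))

    toℕ-lift : {h : ℕ → ℕ} (h-closed : ClosedBelow n h) (x : Fin n) → toℕ (lift h-closed x) ≡ h (toℕ x)
    toℕ-lift h-closed x = toℕ-fromℕ< (h-closed (toℕ<n x))

  restrictPermutation : Permutation′ n
  restrictPermutation = permutation (lift f-closed) (lift g-closed)
    (λ x → toℕ-injective (trans (toℕ-lift f-closed _)
                           (trans (cong f (toℕ-lift g-closed x)) (f∘g≡id (toℕ<n x)))))
    (λ x → toℕ-injective (trans (toℕ-lift g-closed _)
                           (trans (cong g (toℕ-lift f-closed x)) (g∘f≡id (toℕ<n x)))))

  toℕ-restrictPermutation : ∀ x → toℕ (restrictPermutation ⟨$⟩ʳ x) ≡ f (toℕ x)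
  toℕ-restrictPermutation = toℕ-lift f-closed

data Split (q : ℕ) : ℕ → Set where
  below : ∀ {x} → x < q → Split q x
  above : ∀ z → Split q (q + z)

split : ∀ q x → Split q x
split q x with x <? q
... | yes x<q = below x<q
... | no  x≮q = subst (Split q) (m+[n∸m]≡n (≮⇒≥ x≮q)) (above (x ∸ q))

piecewise : ℕ → (ℕ → ℕ) → (ℕ → ℕ) → ℕ → ℕ
piecewise q f h x with x <? q
... | yes _ = f x
... | no  _ = h (x ∸ q)

module _ {q : ℕ} {f h : ℕ → ℕ} where

  piecewise-< : ∀ {x} → x < q → piecewise q f h x ≡ f x
  piecewise-< {x} x<q with x <? q
  ... | yes _   = refl
  ... | no  x≮q = contradiction x<q x≮q

  piecewise-+ : ∀ z → piecewise q f h (q + z) ≡ h z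
  piecewise-+ z with q + z <? q
  ... | yes q+z<q = contradiction q+z<q (m+n≮m q z)
  ... | no  _     = cong h (m+n∸m≡n q z)

juxtapose : ℕ → (ℕ → ℕ) → (ℕ → ℕ) → ℕ → ℕ
juxtapose q f g = piecewise q f (λ z → q + g z)

module _ {q : ℕ} {f g : ℕ → ℕ} where

  juxtapose-below : ∀ {x} → x < q → juxtapose q f g x ≡ f x
  juxtapose-below = piecewise-< {q} {f}

  juxtapose-above : ∀ z → juxtapose q f g (q + z) ≡ q + g z
  juxtapose-above = piecewise-+ {q} {f}

  juxtapose-closed : ∀ {m} → ClosedBelow q f → ClosedBelow m g → ClosedBelow (q + m) (juxtapose q f g)
  juxtapose-closed {m} f-closed g-closed {x} x<q+m with split q x
  ... | below x<q =
    subst (_< q + m) (sym (juxtapose-below x<q)) (<-≤-trans (f-closed x<q) (m≤m+n q m))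
  ... | above z   =
    subst (_< q + m) (sym (juxtapose-above z)) (+-monoʳ-< q (g-closed (+-cancelˡ-< q z m x<q+m)))

  fold-juxtapose-below : ClosedBelow q f → ∀ {x} → x < q →
                         ∀ j → fold x (juxtapose q f g) j ≡ fold x f j
  fold-juxtapose-below f-closed x<q zero    = refl
  fold-juxtapose-below f-closed x<q (suc j) rewrite fold-juxtapose-below f-closed x<q j =
    juxtapose-below (fold-closed j)
    where
    fold-closed : ∀ j → fold _ f j < q
    fold-closed zero    = x<q
    fold-closed (suc j) = f-closed (fold-closed j)

  fold-juxtapose-above : ∀ z j → fold (q + z) (juxtapose q f g) j ≡ q + fold z g j
  fold-juxtapose-above z zero    = refl
  fold-juxtapose-above z (suc j) rewrite fold-juxtapose-above z j = juxtapose-above (fold z g j)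

  exactPeriod-juxtapose-below : ClosedBelow q f → ∀ {x L} → x < q → ExactPeriod f x L →
                                ExactPeriod (juxtapose q f g) x L
  exactPeriod-juxtapose-below f-closed {x} {L} x<q p = record
    { positive = positive
    ; returns  = trans (fold-juxtapose-below f-closed x<q L) returns
    ; minimal  = λ {j} 1≤j j<L → minimal 1≤j j<L ∘ trans (sym (fold-juxtapose-below f-closed x<q j))
    }
    where open ExactPeriod p

  exactPeriod-juxtapose-above : ∀ {z L} → ExactPeriod g z L → ExactPeriod (juxtapose q f g) (q + z) L
  exactPeriod-juxtapose-above {z} {L} p = record
    { positive = positive
    ; returns  = trans (fold-juxtapose-above z L) (cong (q +_) returns)
    ; minimal  = λ {j} 1≤j j<L →
        minimal 1≤j j<L ∘ +-cancelˡ-≡ q _ _ ∘ trans (sym (fold-juxtapose-above z j))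
    }
    where open ExactPeriod p

juxtapose-inverse : ∀ {q m} {f f′ g g′ : ℕ → ℕ} → ClosedBelow q f′ → ClosedBelow m g′ →
                    InverseBelow q f f′ → InverseBelow m g g′ →
                    InverseBelow (q + m) (juxtapose q f g) (juxtapose q f′ g′)
juxtapose-inverse {q} {m} {f} {f′} {g} {g′} f′-closed g′-closed f∘f′≡id g∘g′≡id {x} x<q+m
  with split q x
... | below x<q = begin
  juxtapose q f g (juxtapose q f′ g′ x) ≡⟨ cong (juxtapose q f g) (juxtapose-below {f = f′} {g′} x<q) ⟩
  juxtapose q f g (f′ x)                ≡⟨ juxtapose-below {f = f} {g} (f′-closed x<q) ⟩
  f (f′ x)                              ≡⟨ f∘f′≡id x<q ⟩
  x                                     ∎
  where open ≡-Reasoning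
... | above z = begin
  juxtapose q f g (juxtapose q f′ g′ (q + z))
    ≡⟨ cong (juxtapose q f g) (juxtapose-above {f = f′} {g′} z) ⟩
  juxtapose q f g (q + g′ z)                  ≡⟨ juxtapose-above {f = f} {g} (g′ z) ⟩
  q + g (g′ z)                                ≡⟨ cong (q +_) (g∘g′≡id (+-cancelˡ-< q z m x<q+m)) ⟩
  q + z                                       ∎
  where open ≡-Reasoning

-- Congruences

%≡%⇒∣∸ : ∀ {d} .{{_ : NonZero d}} {x y} → x % d ≡ y % d → d ∣ y ∸ x
%≡%⇒∣∸ {d} {x} {y} x%d≡y%d = divides (y / d ∸ x / d) (begin
  y ∸ x
    ≡⟨ cong₂ _∸_ (m≡m%n+[m/n]*n y d) (m≡m%n+[m/n]*n x d) ⟩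
  (y % d + y / d * d) ∸ (x % d + x / d * d)
    ≡⟨ cong (λ r → (r + y / d * d) ∸ (x % d + x / d * d)) (sym x%d≡y%d) ⟩
  (x % d + y / d * d) ∸ (x % d + x / d * d)
    ≡⟨ [m+n]∸[m+o]≡n∸o (x % d) _ _ ⟩
  y / d * d ∸ x / d * d                     ≡⟨ sym (*-distribʳ-∸ d (y / d) (x / d)) ⟩
  (y / d ∸ x / d) * d                       ∎)
  where open ≡-Reasoning

∣∸⇒%≡% : ∀ {d} .{{_ : NonZero d}} {x y} → x ≤ y → d ∣ y ∸ x → x % d ≡ y % d
∣∸⇒%≡% {d} {x} x≤y d∣y∸x = trans (sym (%-remove-+ʳ x d∣y∸x)) (cong (_% d) (m+[n∸m]≡n x≤y))

module _ {a b c} .{{_ : NonZero a}} .{{_ : NonZero b}} .{{_ : NonZero c}} (c∣lcm : c ∣ lcm a b) where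

  %≡%-lcm⇒∣∸ : ∀ {x y} → x % a ≡ y % a → x % b ≡ y % b → c ∣ y ∸ x
  %≡%-lcm⇒∣∸ x≡y[a] x≡y[b] = ∣-trans c∣lcm (lcm-least (%≡%⇒∣∸ x≡y[a]) (%≡%⇒∣∸ x≡y[b]))

  %≡%-lcm : ∀ {x y} → x % a ≡ y % a → x % b ≡ y % b → x % c ≡ y % c
  %≡%-lcm {x} {y} x≡y[a] x≡y[b] with ≤-total x y
  ... | inj₁ x≤y = ∣∸⇒%≡% x≤y (%≡%-lcm⇒∣∸ x≡y[a] x≡y[b])
  ... | inj₂ y≤x = sym (∣∸⇒%≡% y≤x (%≡%-lcm⇒∣∸ (sym x≡y[a]) (sym x≡y[b])))

[m%d+n]%d≡[m+n]%d : ∀ m n d .{{_ : NonZero d}} → (m % d + n) % d ≡ (m + n) % d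
[m%d+n]%d≡[m+n]%d m n d = begin
  (m % d + n) % d           ≡⟨ %-distribˡ-+ (m % d) n d ⟩
  (m % d % d + n % d) % d   ≡⟨ cong (λ r → (r + n % d) % d) (m%n%n≡m%n m d) ⟩
  (m % d + n % d) % d       ≡⟨ sym (%-distribˡ-+ m n d) ⟩
  (m + n) % d               ∎
  where open ≡-Reasoning

suc[m%d]%d≡suc[m]%d : ∀ m d .{{_ : NonZero d}} → suc (m % d) % d ≡ suc m % d
suc[m%d]%d≡suc[m]%d m d = begin
  suc (m % d) % d ≡⟨ cong (_% d) (+-comm 1 (m % d)) ⟩
  (m % d + 1) % d ≡⟨ [m%d+n]%d≡[m+n]%d m 1 d ⟩
  (m + 1) % d     ≡⟨ cong (_% d) (+-comm m 1) ⟩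
  suc m % d       ∎
  where open ≡-Reasoning

-- Permutations with a prescribed cycle structure

rotate : ℕ → ℕ → ℕ
rotate p x = suc x % suc p

rotate⁻¹ : ℕ → ℕ → ℕ
rotate⁻¹ p x = (x + p) % suc p

module _ (p : ℕ) where

  rotate-closed : ClosedBelow (suc p) (rotate p)
  rotate-closed {x} _ = m%n<n (suc x) (suc p)

  rotate⁻¹-closed : ClosedBelow (suc p) (rotate⁻¹ p)
  rotate⁻¹-closed {x} _ = m%n<n (x + p) (suc p)

  rotate∘rotate⁻¹ : InverseBelow (suc p) (rotate p) (rotate⁻¹ p)
  rotate∘rotate⁻¹ {x} x<1+p = begin
    suc ((x + p) % suc p) % suc p ≡⟨ suc[m%d]%d≡suc[m]%d (x + p) (suc p) ⟩
    suc (x + p) % suc p           ≡⟨ cong (_% suc p) (sym (+-suc x p)) ⟩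
    (x + suc p) % suc p           ≡⟨ [m+n]%n≡m%n x (suc p) ⟩
    x % suc p                     ≡⟨ m<n⇒m%n≡m x<1+p ⟩
    x                             ∎
    where open ≡-Reasoning

  rotate⁻¹∘rotate : InverseBelow (suc p) (rotate⁻¹ p) (rotate p)
  rotate⁻¹∘rotate {x} x<1+p = begin
    (suc x % suc p + p) % suc p ≡⟨ [m%d+n]%d≡[m+n]%d (suc x) p (suc p) ⟩
    suc (x + p) % suc p         ≡⟨ cong (_% suc p) (sym (+-suc x p)) ⟩
    (x + suc p) % suc p         ≡⟨ [m+n]%n≡m%n x (suc p) ⟩
    x % suc p                   ≡⟨ m<n⇒m%n≡m x<1+p ⟩
    x                           ∎
    where open ≡-Reasoning

  fold-rotate : ∀ {x} → x < suc p → ∀ j → fold x (rotate p) j ≡ (x + j) % suc p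
  fold-rotate {x} x<1+p zero    = sym (trans (cong (_% suc p) (+-identityʳ x)) (m<n⇒m%n≡m x<1+p))
  fold-rotate {x} x<1+p (suc j) = begin
    suc (fold x (rotate p) j) % suc p ≡⟨ cong (λ r → suc r % suc p) (fold-rotate x<1+p j) ⟩
    suc ((x + j) % suc p) % suc p     ≡⟨ suc[m%d]%d≡suc[m]%d (x + j) (suc p) ⟩
    suc (x + j) % suc p               ≡⟨ cong (_% suc p) (sym (+-suc x j)) ⟩
    (x + suc j) % suc p               ∎
    where open ≡-Reasoning

  exactPeriod-rotate : ∀ {x} → x < suc p → ExactPeriod (rotate p) x (suc p)
  exactPeriod-rotate {x} x<1+p = record
    { positive = s≤s z≤n
    ; returns  = trans (fold-rotate x<1+p (suc p)) (trans ([m+n]%n≡m%n x (suc p)) (m<n⇒m%n≡m x<1+p))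
    ; minimal  = minimal
    }
    where
    minimal : ∀ {j} → 1 ≤ j → j < suc p → fold x (rotate p) j ≢ x
    minimal {j} 1≤j j<1+p rʲx≡x = <⇒≱ j<1+p (∣⇒≤ {{>-nonZero 1≤j}} 1+p∣j)
      where
      x≡x+j : x % suc p ≡ (x + j) % suc p
      x≡x+j = trans (m<n⇒m%n≡m x<1+p) (sym (trans (sym (fold-rotate x<1+p j)) rʲx≡x))
      1+p∣j : suc p ∣ j
      1+p∣j = subst (suc p ∣_) (m+n∸m≡n x j) (%≡%⇒∣∸ {x = x} {x + j} x≡x+j)

-- A block list cuts [0, total ps) into consecutive intervals, an entry p
-- standing for an interval of length suc p.

total : List ℕ → ℕ
total []       = 0
total (p ∷ ps) = suc p + total ps

blockRotation : List ℕ → ℕ → ℕ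
blockRotation []       = id
blockRotation (p ∷ ps) = juxtapose (suc p) (rotate p) (blockRotation ps)

blockRotation⁻¹ : List ℕ → ℕ → ℕ
blockRotation⁻¹ []       = id
blockRotation⁻¹ (p ∷ ps) = juxtapose (suc p) (rotate⁻¹ p) (blockRotation⁻¹ ps)

blockLength : List ℕ → ℕ → ℕ
blockLength []       _ = 0
blockLength (p ∷ ps)   = piecewise (suc p) (λ _ → suc p) (blockLength ps)

module _ {p : ℕ} {ps : List ℕ} where

  blockLength-below : ∀ {x} → x < suc p → blockLength (p ∷ ps) x ≡ suc p
  blockLength-below = piecewise-< {suc p} {λ _ → suc p} {blockLength ps}

  blockLength-above : ∀ z → blockLength (p ∷ ps) (suc p + z) ≡ blockLength ps z
  blockLength-above = piecewise-+ {suc p} {λ _ → suc p} {blockLength ps}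

blockRotation-closed : ∀ ps → ClosedBelow (total ps) (blockRotation ps)
blockRotation-closed (p ∷ ps) = juxtapose-closed (rotate-closed p) (blockRotation-closed ps)

blockRotation⁻¹-closed : ∀ ps → ClosedBelow (total ps) (blockRotation⁻¹ ps)
blockRotation⁻¹-closed (p ∷ ps) = juxtapose-closed (rotate⁻¹-closed p) (blockRotation⁻¹-closed ps)

blockRotation-inverseˡ : ∀ ps → InverseBelow (total ps) (blockRotation ps) (blockRotation⁻¹ ps)
blockRotation-inverseˡ (p ∷ ps) = juxtapose-inverse (rotate⁻¹-closed p) (blockRotation⁻¹-closed ps)
                                    (rotate∘rotate⁻¹ p) (blockRotation-inverseˡ ps)

blockRotation-inverseʳ : ∀ ps → InverseBelow (total ps) (blockRotation⁻¹ ps) (blockRotation ps)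
blockRotation-inverseʳ (p ∷ ps) = juxtapose-inverse (rotate-closed p) (blockRotation-closed ps)
                                    (rotate⁻¹∘rotate p) (blockRotation-inverseʳ ps)

blockLength≤total : ∀ ps {x} → x < total ps → blockLength ps x ≤ total ps
blockLength≤total (p ∷ ps) {x} x<total with split (suc p) x
... | below x<1+p rewrite blockLength-below {p} {ps} x<1+p = m≤m+n (suc p) (total ps)
... | above z     rewrite blockLength-above {p} {ps} z =
  ≤-trans (blockLength≤total ps (+-cancelˡ-< (suc p) z (total ps) x<total)) (m≤n+m (total ps) (suc p))

exactPeriod-blockRotation : ∀ ps {x} → x < total ps → ExactPeriod (blockRotation ps) x (blockLength ps x)
exactPeriod-blockRotation (p ∷ ps) {x} x<total with split (suc p) x
... | below x<1+p rewrite blockLength-below {p} {ps} x<1+p =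
  exactPeriod-juxtapose-below (rotate-closed p) x<1+p (exactPeriod-rotate p x<1+p)
... | above z     rewrite blockLength-above {p} {ps} z =
  exactPeriod-juxtapose-above (exactPeriod-blockRotation ps (+-cancelˡ-< (suc p) z (total ps) x<total))

blockPermutation : ∀ {n} ps → total ps ≡ n → Permutation′ n
blockPermutation ps refl = restrictPermutation (blockRotation-closed ps) (blockRotation⁻¹-closed ps)
                             (blockRotation-inverseˡ ps) (blockRotation-inverseʳ ps)

toℕ-blockPermutation : ∀ {n} ps (total≡n : total ps ≡ n) x →
                       toℕ (blockPermutation ps total≡n ⟨$⟩ʳ x) ≡ blockRotation ps (toℕ x)
toℕ-blockPermutation ps refl =
  toℕ-restrictPermutation {f = blockRotation ps} {blockRotation⁻¹ ps} (blockRotation-closed ps)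
    (blockRotation⁻¹-closed ps) (blockRotation-inverseˡ ps) (blockRotation-inverseʳ ps)

orbitLen-blockPermutation : ∀ {n} ps (total≡n : total ps ≡ n) x →
                            orbitLen (blockPermutation ps total≡n) x ≡ blockLength ps (toℕ x)
orbitLen-blockPermutation ps total≡n@refl x =
  orbitLen-exact _ (exactPeriod-toℕ (toℕ-blockPermutation ps total≡n) (exactPeriod-blockRotation ps (toℕ<n x)))
                 (blockLength≤total ps (toℕ<n x))

indicator : Bool → ℕ
indicator b = if b then 1 else 0

count : (ℕ → Bool) → ℕ → ℕ
count q zero    = 0
count q (suc m) = indicator (q 0) + count (q ∘ suc) m

length-filterᵇ-∷ : ∀ {A : Set} (p : A → Bool) x xs →
                   length (filterᵇ p (x ∷ xs)) ≡ indicator (p x) + length (filterᵇ p xs)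
length-filterᵇ-∷ p x xs with p x
... | true  = refl
... | false = refl

length-filterᵇ-tabulate : ∀ {A : Set} {m} (f : Fin m → A) {p : A → Bool} {q : ℕ → Bool} →
                          (∀ i → p (f i) ≡ q (toℕ i)) → length (filterᵇ p (List.tabulate f)) ≡ count q m
length-filterᵇ-tabulate {m = zero}  f p≡q = refl
length-filterᵇ-tabulate {m = suc m} f {p} p≡q =
  trans (length-filterᵇ-∷ p (f Fin.zero) _)
        (cong₂ _+_ (cong indicator (p≡q Fin.zero)) (length-filterᵇ-tabulate (f ∘ Fin.suc) (p≡q ∘ Fin.suc)))

count-+ : ∀ q m k → count q (m + k) ≡ count q m + count (λ y → q (m + y)) k
count-+ q zero    k = refl
count-+ q (suc m) k = trans (cong (indicator (q 0) +_) (count-+ (q ∘ suc) m k))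
                            (sym (+-assoc (indicator (q 0)) _ _))

count-cong : ∀ {q q′} m → (∀ {y} → y < m → q y ≡ q′ y) → count q m ≡ count q′ m
count-cong zero    q≡q′ = refl
count-cong (suc m) q≡q′ = cong₂ _+_ (cong indicator (q≡q′ z<s)) (count-cong m (q≡q′ ∘ s<s))

count-const : ∀ b m → count (λ _ → b) m ≡ indicator b * m
count-const b zero    = sym (*-zeroʳ (indicator b))
count-const b (suc m) = trans (cong (indicator b +_) (count-const b m)) (sym (*-suc (indicator b) m))

indicator[m≡ᵇn]*m≡indicator[m≡ᵇn]*n : ∀ m n → indicator (m ≡ᵇ n) * m ≡ indicator (m ≡ᵇ n) * n
indicator[m≡ᵇn]*m≡indicator[m≡ᵇn]*n m n with m ≡ᵇ n in eq
... | true  = cong (1 *_) (≡ᵇ⇒≡ m n (subst T (sym eq) tt))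
... | false = refl

blockCount : ℕ → List ℕ → ℕ
blockCount L []       = 0
blockCount L (p ∷ ps) = indicator (suc p ≡ᵇ L) + blockCount L ps

count-blockLength : ∀ L ps → count (λ y → blockLength ps y ≡ᵇ L) (total ps) ≡ blockCount L ps * L
count-blockLength L []       = refl
count-blockLength L (p ∷ ps) = begin
  count q (suc p + total ps)                               ≡⟨ count-+ q (suc p) (total ps) ⟩
  count q (suc p) + count (λ y → q (suc p + y)) (total ps) ≡⟨ cong₂ _+_ first-block rest ⟩
  indicator (suc p ≡ᵇ L) * L + blockCount L ps * L
    ≡⟨ sym (*-distribʳ-+ L (indicator (suc p ≡ᵇ L)) _) ⟩
  blockCount L (p ∷ ps) * L                                ∎
  where
  open ≡-Reasoning
  q = λ y → blockLength (p ∷ ps) y ≡ᵇ L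
  first-block : count q (suc p) ≡ indicator (suc p ≡ᵇ L) * L
  first-block = trans (count-cong (suc p) (cong (_≡ᵇ L) ∘ blockLength-below {p} {ps}))
                      (trans (count-const _ (suc p)) (indicator[m≡ᵇn]*m≡indicator[m≡ᵇn]*n (suc p) L))
  rest : count (λ y → q (suc p + y)) (total ps) ≡ blockCount L ps * L
  rest = trans (count-cong (total ps) (λ {y} _ → cong (_≡ᵇ L) (blockLength-above {p} {ps} y)))
               (count-blockLength L ps)

blockCounts : ∀ {n} → List ℕ → Vec ℕ n
blockCounts ps = Vec.tabulate (λ ℓ → blockCount (suc (toℕ ℓ)) ps)

cycleStructure-blockPermutation : ∀ {n} ps (total≡n : total ps ≡ n) →
                                  cycleStructure (blockPermutation ps total≡n) ≡ blockCounts ps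
cycleStructure-blockPermutation ps total≡n@refl = Vec.tabulate-cong cycles
  where
  α = blockPermutation ps total≡n
  points : ∀ L → pointsOnCyclesOfLength α L ≡ blockCount L ps * L
  points L = trans (length-filterᵇ-tabulate id (λ x → cong (_≡ᵇ L) (orbitLen-blockPermutation ps total≡n x)))
                   (count-blockLength L ps)
  cycles : ∀ ℓ → pointsOnCyclesOfLength α (suc (toℕ ℓ)) / suc (toℕ ℓ) ≡ blockCount (suc (toℕ ℓ)) ps
  cycles ℓ = trans (cong (_/ suc (toℕ ℓ)) (points (suc (toℕ ℓ)))) (m*n/n≡m _ (suc (toℕ ℓ)))

blocksFrom : ∀ {m} → ℕ → Vec ℕ m → List ℕ
blocksFrom k []      = []
blocksFrom k (x ∷ v) = replicate x k ++ blocksFrom (suc k) v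

total-++ : ∀ ps qs → total (ps ++ qs) ≡ total ps + total qs
total-++ []       qs = refl
total-++ (p ∷ ps) qs = trans (cong (suc p +_) (total-++ ps qs)) (sym (+-assoc (suc p) (total ps) (total qs)))

total-replicate : ∀ x k → total (replicate x k) ≡ suc k * x
total-replicate zero    k = sym (*-zeroʳ (suc k))
total-replicate (suc x) k = trans (cong (suc k +_) (total-replicate x k)) (sym (*-suc (suc k) x))

total-blocksFrom : ∀ {m} k (v : Vec ℕ m) → total (blocksFrom k v) ≡ weightFrom (suc k) v
total-blocksFrom k []      = refl
total-blocksFrom k (x ∷ v) = trans (total-++ (replicate x k) _)
                                   (cong₂ _+_ (total-replicate x k) (total-blocksFrom (suc k) v))

blockCount-++ : ∀ L ps qs → blockCount L (ps ++ qs) ≡ blockCount L ps + blockCount L qs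
blockCount-++ L []       qs = refl
blockCount-++ L (p ∷ ps) qs = trans (cong (indicator (suc p ≡ᵇ L) +_) (blockCount-++ L ps qs))
                                    (sym (+-assoc (indicator (suc p ≡ᵇ L)) _ _))

blockCount-replicate : ∀ L x k → blockCount L (replicate x k) ≡ indicator (suc k ≡ᵇ L) * x
blockCount-replicate L zero    k = sym (*-zeroʳ (indicator (suc k ≡ᵇ L)))
blockCount-replicate L (suc x) k = trans (cong (indicator (suc k ≡ᵇ L) +_) (blockCount-replicate L x k))
                                         (sym (*-suc (indicator (suc k ≡ᵇ L)) x))

indicator-≡ᵇ-≢ : ∀ {m n} → m ≢ n → indicator (m ≡ᵇ n) ≡ 0
indicator-≡ᵇ-≢ {m} {n} m≢n with m ≡ᵇ n in eq
... | true  = contradiction (≡ᵇ⇒≡ m n (subst T (sym eq) tt)) m≢n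
... | false = refl

indicator-≡ᵇ-refl : ∀ m → indicator (m ≡ᵇ m) ≡ 1
indicator-≡ᵇ-refl zero    = refl
indicator-≡ᵇ-refl (suc m) = indicator-≡ᵇ-refl m

blockCount-blocksFrom-∷ : ∀ {m} L k x (v : Vec ℕ m) →
  blockCount L (blocksFrom k (x ∷ v)) ≡ indicator (suc k ≡ᵇ L) * x + blockCount L (blocksFrom (suc k) v)
blockCount-blocksFrom-∷ L k x v =
  trans (blockCount-++ L (replicate x k) _) (cong (_+ _) (blockCount-replicate L x k))

blockCount-blocksFrom-< : ∀ {m j k} → j < k → (v : Vec ℕ m) → blockCount (suc j) (blocksFrom k v) ≡ 0
blockCount-blocksFrom-<         j<k []      = refl
blockCount-blocksFrom-< {j = j} j<k (x ∷ v) = trans (blockCount-blocksFrom-∷ (suc j) _ x v)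
  (cong₂ _+_ (cong (_* x) (indicator-≡ᵇ-≢ (>⇒≢ (s<s j<k)))) (blockCount-blocksFrom-< (m<n⇒m<1+n j<k) v))

blockCount-blocksFrom : ∀ {m} k (v : Vec ℕ m) ℓ →
                        blockCount (suc (k + toℕ ℓ)) (blocksFrom k v) ≡ Vec.lookup v ℓ
blockCount-blocksFrom k (x ∷ v) Fin.zero rewrite +-identityʳ k = begin
  blockCount (suc k) (blocksFrom k (x ∷ v))
    ≡⟨ blockCount-blocksFrom-∷ (suc k) k x v ⟩
  indicator (suc k ≡ᵇ suc k) * x + blockCount (suc k) (blocksFrom (suc k) v)
    ≡⟨ cong₂ _+_ (cong (_* x) (indicator-≡ᵇ-refl k)) (blockCount-blocksFrom-< (n<1+n k) v) ⟩
  1 * x + 0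
    ≡⟨ trans (+-identityʳ _) (*-identityˡ x) ⟩
  x ∎
  where open ≡-Reasoning
blockCount-blocksFrom k (x ∷ v) (Fin.suc ℓ) rewrite +-suc k (toℕ ℓ) =
  trans (blockCount-blocksFrom-∷ _ k x v)
        (cong₂ _+_ (cong (_* x) (indicator-≡ᵇ-≢ (<⇒≢ (s<s (s≤s (m≤m+n k (toℕ ℓ)))))))
                   (blockCount-blocksFrom (suc k) v ℓ))

blocksFrom-head : ∀ {m} k (v : Vec ℕ m) {i} → shortestFrom (suc k) v ≡ suc i →
                  ∃ λ rest → blocksFrom k v ≡ i ∷ rest
blocksFrom-head k (zero  ∷ v) shortest≡1+i = blocksFrom-head (suc k) v shortest≡1+i
blocksFrom-head k (suc x ∷ v) shortest≡1+i =
  replicate x k ++ blocksFrom (suc k) v , cong (_∷ _) (suc-injective shortest≡1+i)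

residue : ∀ {n} d .{{_ : NonZero d}} → .(d ≤ n) → ℕ → Fin n
residue d d≤n t = fromℕ< (<-≤-trans (m%n<n t d) d≤n)

module _ {n} (d : ℕ) .{{_ : NonZero d}} .(d≤n : d ≤ n) where

  toℕ-residue : ∀ t → toℕ (residue d d≤n t) ≡ t % d
  toℕ-residue t = toℕ-fromℕ< _

  residue≡⇒%≡ : ∀ {s t} → residue d d≤n s ≡ residue d d≤n t → s % d ≡ t % d
  residue≡⇒%≡ {s} {t} eq = trans (sym (toℕ-residue s)) (trans (cong toℕ eq) (toℕ-residue t))

  %≡⇒residue≡ : ∀ {s t} → s % d ≡ t % d → residue d d≤n s ≡ residue d d≤n t
  %≡⇒residue≡ {s} {t} eq = toℕ-injective (trans (toℕ-residue s) (trans eq (sym (toℕ-residue t))))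

  residue-%-∣ : ∀ {m} .{{_ : NonZero m}} → d ∣ m → ∀ t → residue d d≤n (t % m) ≡ residue d d≤n t
  residue-%-∣ {m} d∣m t = %≡⇒residue≡ (m∣n⇒o%n%m≡o%m d m t d∣m)

  residue-+-∣ : ∀ {m} → d ∣ m → ∀ t → residue d d≤n (t + m) ≡ residue d d≤n t
  residue-+-∣ d∣m t = %≡⇒residue≡ (%-remove-+ʳ t d∣m)

Rotates : ∀ {n} → Permutation′ n → ∀ d .{{_ : NonZero d}} → .(d ≤ n) → Set
Rotates π d d≤n = ∀ t → π ⟨$⟩ʳ residue d d≤n t ≡ residue d d≤n (suc t)

blockPermutation-rotates : ∀ {n} p ps (total≡n : total (p ∷ ps) ≡ n) .(1+p≤n : suc p ≤ n) →
                           Rotates (blockPermutation (p ∷ ps) total≡n) (suc p) 1+p≤n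
blockPermutation-rotates p ps total≡n 1+p≤n t = toℕ-injective (begin
  toℕ (blockPermutation (p ∷ ps) total≡n ⟨$⟩ʳ residue (suc p) 1+p≤n t)
    ≡⟨ toℕ-blockPermutation (p ∷ ps) total≡n _ ⟩
  blockRotation (p ∷ ps) (toℕ (residue (suc p) 1+p≤n t))
    ≡⟨ cong (blockRotation (p ∷ ps)) (toℕ-residue (suc p) 1+p≤n t) ⟩
  blockRotation (p ∷ ps) (t % suc p)
    ≡⟨ juxtapose-below {f = rotate p} {blockRotation ps} (m%n<n t (suc p)) ⟩
  suc (t % suc p) % suc p
    ≡⟨ suc[m%d]%d≡suc[m]%d t (suc p) ⟩
  suc t % suc p
    ≡⟨ sym (toℕ-residue (suc p) 1+p≤n (suc t)) ⟩
  toℕ (residue (suc p) 1+p≤n (suc t))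
    ∎)
  where open ≡-Reasoning

record RotatingRealisation {n} (a : Vec ℕ n) (d : ℕ) .{{_ : NonZero d}} : Set where
  field
    d≤n             : d ≤ n
    perm            : Permutation′ n
    cycleStructure≡ : cycleStructure perm ≡ a
    rotates         : Rotates perm d d≤n

rotatingRealisation : ∀ {n} (a : Vec ℕ n) {i} → weight a ≡ n → shortest a ≡ suc i →
                      RotatingRealisation a (suc i)
rotatingRealisation {n} a {i} weight≡n shortest≡1+i with blocksFrom-head 0 a shortest≡1+i
... | rest , blocks≡ = record
  { d≤n             = 1+i≤n
  ; perm            = blockPermutation (i ∷ rest) total≡n
  ; cycleStructure≡ = begin
      cycleStructure (blockPermutation (i ∷ rest) total≡n)
        ≡⟨ cycleStructure-blockPermutation (i ∷ rest) total≡n ⟩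
      blockCounts (i ∷ rest)       ≡⟨ cong blockCounts (sym blocks≡) ⟩
      blockCounts (blocksFrom 0 a) ≡⟨ Vec.tabulate-cong (blockCount-blocksFrom 0 a) ⟩
      Vec.tabulate (Vec.lookup a)  ≡⟨ Vec.tabulate∘lookup a ⟩
      a                            ∎
  ; rotates         = blockPermutation-rotates i rest total≡n 1+i≤n
  }
  where
  open ≡-Reasoning
  total≡n : total (i ∷ rest) ≡ n
  total≡n = trans (cong total (sym blocks≡)) (trans (total-blocksFrom 0 a) weight≡n)
  1+i≤n : suc i ≤ n
  1+i≤n = subst (suc i ≤_) total≡n (m≤m+n (suc i) (total rest))

-- The partial Latin square

module OrbitSquare {n I J K : ℕ} .{{_ : NonZero I}} .{{_ : NonZero J}} .{{_ : NonZero K}}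
  (I≤n : I ≤ n) (J≤n : J ≤ n) (K≤n : K ≤ n)
  (I∣lcm[J,K] : I ∣ lcm J K) (J∣lcm[I,K] : J ∣ lcm I K) (K∣lcm[I,J] : K ∣ lcm I J) where

  row col symbol : ℕ → Fin n
  row    = residue I I≤n
  col    = residue J J≤n
  symbol = residue K K≤n

  Cell : Fin n → Fin n → Fin n → Set
  Cell r c s = ∃ λ t → row t ≡ r × col t ≡ c × symbol t ≡ s

  row-col⇒symbol : ∀ {s t} → row s ≡ row t → col s ≡ col t → symbol s ≡ symbol t
  row-col⇒symbol eq₁ eq₂ =
    %≡⇒residue≡ K K≤n (%≡%-lcm K∣lcm[I,J] (residue≡⇒%≡ I I≤n eq₁) (residue≡⇒%≡ J J≤n eq₂))

  row-symbol⇒col : ∀ {s t} → row s ≡ row t → symbol s ≡ symbol t → col s ≡ col t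
  row-symbol⇒col eq₁ eq₂ =
    %≡⇒residue≡ J J≤n (%≡%-lcm J∣lcm[I,K] (residue≡⇒%≡ I I≤n eq₁) (residue≡⇒%≡ K K≤n eq₂))

  col-symbol⇒row : ∀ {s t} → col s ≡ col t → symbol s ≡ symbol t → row s ≡ row t
  col-symbol⇒row eq₁ eq₂ =
    %≡⇒residue≡ I I≤n (%≡%-lcm I∣lcm[J,K] (residue≡⇒%≡ J J≤n eq₁) (residue≡⇒%≡ K K≤n eq₂))

  -- Any common multiple of I, J and K would do: it bounds the search for a cell.
  period : ℕ
  period = I * J * K

  instance
    period≢0 : NonZero period
    period≢0 = m*n≢0 (I * J) K {{m*n≢0 I J}}

  I∣period : I ∣ period
  I∣period = ∣-trans (m∣m*n J) (m∣m*n K)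

  J∣period : J ∣ period
  J∣period = n∣m*n*o I K

  K∣period : K ∣ period
  K∣period = n∣m*n (I * J)

  FoundAt : Fin n → Fin n → Set
  FoundAt r c = ∃ λ (t : Fin period) → row (toℕ t) ≡ r × col (toℕ t) ≡ c

  cellAt : ∀ {r c} → Dec (FoundAt r c) → Maybe (Fin n)
  cellAt (yes (t , _)) = just (symbol (toℕ t))
  cellAt (no _)        = nothing

  found? : ∀ r c → Dec (FoundAt r c)
  found? r c = any? λ t → row (toℕ t) ≟ r ×-dec col (toℕ t) ≟ c

  square : PLS n
  square r c = cellAt (found? r c)

  square-sound : ∀ {r c s} → square r c ≡ just s → Cell r c s
  square-sound {r} {c} = sound (found? r c)
    where
    sound : ∀ {s} (found : Dec (FoundAt r c)) → cellAt found ≡ just s → Cell r c s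
    sound (yes (t , row≡r , col≡c)) refl = toℕ t , row≡r , col≡c , refl

  square-complete : ∀ {r c s} → Cell r c s → square r c ≡ just s
  square-complete {r} {c} {s} (t , row≡r , col≡c , symbol≡s) = complete (found? r c)
    where
    complete : (found : Dec (FoundAt r c)) → cellAt found ≡ just s
    complete (yes (u , row≡r′ , col≡c′)) =
      cong just (trans (row-col⇒symbol (trans row≡r′ (sym row≡r)) (trans col≡c′ (sym col≡c))) symbol≡s)
    complete (no not-found) = contradiction
      ( fromℕ< (m%n<n t period)
      , trans (cong row (toℕ-fromℕ< _)) (trans (residue-%-∣ I I≤n I∣period t) row≡r)
      , trans (cong col (toℕ-fromℕ< _)) (trans (residue-%-∣ J J≤n J∣period t) col≡c) )
      not-found

  square-isPartialLatinSquare : IsPartialLatinSquare square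
  square-isPartialLatinSquare = row-latin , col-latin
    where
    row-latin : ∀ r c c′ s → square r c ≡ just s → square r c′ ≡ just s → c ≡ c′
    row-latin r c c′ s rcs rc′s with square-sound rcs | square-sound rc′s
    ... | t , row≡r , refl , symbol≡s | t′ , row≡r′ , refl , symbol≡s′ =
      row-symbol⇒col (trans row≡r (sym row≡r′)) (trans symbol≡s (sym symbol≡s′))

    col-latin : ∀ r r′ c s → square r c ≡ just s → square r′ c ≡ just s → r ≡ r′
    col-latin r r′ c s rcs r′cs with square-sound rcs | square-sound r′cs
    ... | t , refl , col≡c , symbol≡s | t′ , refl , col≡c′ , symbol≡s′ =
      col-symbol⇒row (trans col≡c (sym col≡c′)) (trans symbol≡s (sym symbol≡s′))

  square-nonEmpty : NonEmpty square
  square-nonEmpty = row 0 , col 0 , symbol 0 , square-complete (0 , refl , refl , refl)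

  square-isAutotopism : ∀ {α β γ} → Rotates α I I≤n → Rotates β J J≤n → Rotates γ K K≤n →
                        IsAutotopism α β γ square
  square-isAutotopism {α} {β} {γ} α-rotates β-rotates γ-rotates = forward , backward
    where
    forward : ∀ r c s → square r c ≡ just s → square (α ⟨$⟩ʳ r) (β ⟨$⟩ʳ c) ≡ just (γ ⟨$⟩ʳ s)
    forward r c s rcs with square-sound rcs
    ... | t , refl , refl , refl =
      square-complete (suc t , sym (α-rotates t) , sym (β-rotates t) , sym (γ-rotates t))

    backward : ∀ r′ c′ s′ → square r′ c′ ≡ just s′ →
               ∃ λ r → ∃ λ c → ∃ λ s →
                 square r c ≡ just s × α ⟨$⟩ʳ r ≡ r′ × β ⟨$⟩ʳ c ≡ c′ × γ ⟨$⟩ʳ s ≡ s′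
    backward r′ c′ s′ r′c′s′ with square-sound r′c′s′
    ... | t , refl , refl , refl =
      row u , col u , symbol u , square-complete (u , refl , refl , refl) ,
      trans (α-rotates u) (trans (cong row    suc-u≡t+period) (residue-+-∣ I I≤n I∣period t)) ,
      trans (β-rotates u) (trans (cong col    suc-u≡t+period) (residue-+-∣ J J≤n J∣period t)) ,
      trans (γ-rotates u) (trans (cong symbol suc-u≡t+period) (residue-+-∣ K K≤n K∣period t))
      where
      u = t + pred period
      suc-u≡t+period : suc u ≡ t + period
      suc-u≡t+period = trans (sym (+-suc t (pred period))) (cong (t +_) (suc-pred period))

-- Enumerating the triples

Unique-concatMap : ∀ {A B : Set} (key : B → A) {f : A → List B} {xs} → Unique xs →
                   (∀ x → Unique (f x)) → (∀ x → All (λ z → key z ≡ x) (f x)) → Unique (concatMap f xs)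
Unique-concatMap key {f} xs! f! keys =
  Unique.concat⁺ (All.map⁺ (All.universal f! _)) (AllPairs.map⁺ (AllPairs.map disjoint xs!))
  where
  disjoint : ∀ {x y} → x ≢ y → Disjoint (f x) (f y)
  disjoint x≢y (z∈fx , z∈fy) = x≢y (trans (sym (All.lookup (keys _) z∈fx)) (All.lookup (keys _) z∈fy))

All-concatMap⁺ : ∀ {A B : Set} {P : B → Set} (f : A → List B) xs →
                 (∀ {x} → x ∈ xs → All P (f x)) → All P (concatMap f xs)
All-concatMap⁺ f xs Pf = All.concat⁺ (All.map⁺ (All.tabulate Pf))

length-concatMap : ∀ {A B : Set} (f : A → List B) xs →
                   length (concatMap f xs) ≡ sum (List.map (length ∘ f) xs)
length-concatMap f []       = refl
length-concatMap f (x ∷ xs) = trans (length-++ (f x)) (cong (length (f x) +_) (length-concatMap f xs))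

length-cartesianProduct : ∀ {A B : Set} (xs : List A) (ys : List B) →
                          length (cartesianProduct xs ys) ≡ length xs * length ys
length-cartesianProduct []       ys = refl
length-cartesianProduct (x ∷ xs) ys =
  trans (length-++ (List.map (x ,_) ys)) (cong₂ _+_ (length-map (x ,_) ys) (length-cartesianProduct xs ys))

Unique-vecsBounded : ∀ m b → Unique (vecsBounded m b)
Unique-vecsBounded zero    b = All.[] AllPairs.∷ AllPairs.[]
Unique-vecsBounded (suc m) b = Unique-concatMap Vec.head (Unique.upTo⁺ (suc b))
  (λ x → Unique.map⁺ Vec.∷-injectiveʳ (Unique-vecsBounded m b))
  (λ x → All.map⁺ (All.universal (λ _ → refl) (vecsBounded m b)))

CS : (n m : ℕ) → List (Vec ℕ n)
CS n m = filterᵇ (λ v → (weight v ≡ᵇ n) ∧ (shortest v ≡ᵇ m)) (vecsBounded n n)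

Unique-CS : ∀ n m → Unique (CS n m)
Unique-CS n m = Unique.filter⁺ _ (Unique-vecsBounded n n)

∈-CS⁻ : ∀ {n m v} → v ∈ CS n m → weight v ≡ n × shortest v ≡ m
∈-CS⁻ {n} {m} {v} v∈CS with Equivalence.to T-∧ (proj₂ (∈-filter⁻ (T? ∘ _) {xs = vecsBounded n n} v∈CS))
... | weight≡ᵇn , shortest≡ᵇm =
  ≡ᵇ⇒≡ (weight v) n weight≡ᵇn , ≡ᵇ⇒≡ (shortest v) m shortest≡ᵇm

lcmTriples : ∀ n → ℕ → ℕ → ℕ → List (CSTriple n)
lcmTriples n i j k =
  if inLCM i j k then cartesianProduct (CS n i) (cartesianProduct (CS n j) (CS n k)) else []

candidates : ∀ n → List (CSTriple n)
candidates n =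
  concatMap (λ i → concatMap (λ j → concatMap (λ k → lcmTriples n i j k) (range1 n)) (range1 n)) (range1 n)

All-lcmTriples⁺ : ∀ {n i j k} {P : CSTriple n → Set} →
                  (T (inLCM i j k) → ∀ {a b c} → a ∈ CS n i → b ∈ CS n j → c ∈ CS n k →
                   P (a , b , c)) →
                  All P (lcmTriples n i j k)
All-lcmTriples⁺ {n} {i} {j} {k} realise with inLCM i j k
... | false = All.[]
... | true  = All.tabulate λ {(a , b , c)} z∈ →
  let a∈ , bc∈ = ∈-cartesianProduct⁻ (CS n i) _ z∈
      b∈ , c∈  = ∈-cartesianProduct⁻ (CS n j) (CS n k) bc∈
  in realise tt a∈ b∈ c∈

Unique-lcmTriples : ∀ n i j k → Unique (lcmTriples n i j k)
Unique-lcmTriples n i j k with inLCM i j k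
... | false = AllPairs.[]
... | true  = Unique.cartesianProduct⁺ (Unique-CS n i) (Unique.cartesianProduct⁺ (Unique-CS n j) (Unique-CS n k))

length-lcmTriples : ∀ n i j k →
  length (lcmTriples n i j k) ≡ (if inLCM i j k then cardCS n i * cardCS n j * cardCS n k else 0)
length-lcmTriples n i j k with inLCM i j k
... | false = refl
... | true  = begin
  length (cartesianProduct (CS n i) (cartesianProduct (CS n j) (CS n k)))
    ≡⟨ length-cartesianProduct (CS n i) _ ⟩
  cardCS n i * length (cartesianProduct (CS n j) (CS n k))
    ≡⟨ cong (cardCS n i *_) (length-cartesianProduct (CS n j) (CS n k)) ⟩
  cardCS n i * (cardCS n j * cardCS n k)
    ≡⟨ sym (*-assoc (cardCS n i) _ _) ⟩
  cardCS n i * cardCS n j * cardCS n k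
    ∎
  where open ≡-Reasoning

length-candidates : ∀ n → length (candidates n) ≡ lcmSum n
length-candidates n =
  trans (length-concatMap _ (range1 n)) (cong sum (map-cong (λ i →
  trans (length-concatMap _ (range1 n)) (cong sum (map-cong (λ j →
  trans (length-concatMap _ (range1 n)) (cong sum (map-cong (length-lcmTriples n i j) (range1 n))))
    (range1 n)))) (range1 n)))

Unique-range1 : ∀ n → Unique (range1 n)
Unique-range1 n = Unique.map⁺ suc-injective (Unique.upTo⁺ n)

shortests : ∀ {n} → CSTriple n → ℕ × ℕ × ℕ
shortests (a , b , c) = shortest a , shortest b , shortest c

lcmTriples-shortests : ∀ n i j k → All (λ z → shortests z ≡ (i , j , k)) (lcmTriples n i j k)
lcmTriples-shortests n i j k = All-lcmTriples⁺ λ _ a∈ b∈ c∈ →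
  cong₂ _,_ (proj₂ (∈-CS⁻ a∈)) (cong₂ _,_ (proj₂ (∈-CS⁻ b∈)) (proj₂ (∈-CS⁻ c∈)))

Unique-candidates : ∀ n → Unique (candidates n)
Unique-candidates n =
  Unique-concatMap (proj₁ ∘ shortests) (Unique-range1 n)
    (λ i → Unique-concatMap (proj₁ ∘ proj₂ ∘ shortests) (Unique-range1 n)
      (λ j → Unique-concatMap (proj₂ ∘ proj₂ ∘ shortests) (Unique-range1 n)
        (Unique-lcmTriples n i j)
        (λ k → All.map (cong (proj₂ ∘ proj₂)) (lcmTriples-shortests n i j k)))
      (λ j → All-concatMap⁺ _ (range1 n) λ {k} _ →
               All.map (cong (proj₁ ∘ proj₂)) (lcmTriples-shortests n i j k)))
    (λ i → All-concatMap⁺ _ (range1 n) λ {j} _ → All-concatMap⁺ _ (range1 n) λ {k} _ →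
             All.map (cong proj₁) (lcmTriples-shortests n i j k))

inLCM⇒∣lcm : ∀ {i j k} → T (inLCM i j k) → i ∣ lcm j k × j ∣ lcm i k × k ∣ lcm i j
inLCM⇒∣lcm {i} {j} {k} h with Equivalence.to T-∧ h
... | ij≡ᵇl , rest with Equivalence.to T-∧ rest
... | ik≡ᵇl , jk≡ᵇl =
  subst (i ∣_) (trans ij≡l (sym jk≡l)) (m∣lcm[m,n] i j) ,
  subst (j ∣_) (trans ij≡l (sym ik≡l)) (n∣lcm[m,n] i j) ,
  subst (k ∣_) (sym ij≡l) (n∣lcm[m,n] (lcm i j) k)
  where
  l = lcm (lcm i j) k
  ij≡l = ≡ᵇ⇒≡ (lcm i j) l ij≡ᵇl
  ik≡l = ≡ᵇ⇒≡ (lcm i k) l ik≡ᵇl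
  jk≡l = ≡ᵇ⇒≡ (lcm j k) l jk≡ᵇl

lcmTriple-realisable : ∀ {n i j k} → T (inLCM (suc i) (suc j) (suc k)) → ∀ {a b c} →
                       a ∈ CS n (suc i) → b ∈ CS n (suc j) → c ∈ CS n (suc k) →
                       InCSAutotopismsPLS (a , b , c)
lcmTriple-realisable {n} {i} {j} {k} h a∈ b∈ c∈ =
  perm ra , perm rb , perm rc , square , square-isPartialLatinSquare , square-nonEmpty ,
  square-isAutotopism {perm ra} {perm rb} {perm rc} (rotates ra) (rotates rb) (rotates rc) ,
  cycleStructure≡ ra , cycleStructure≡ rb , cycleStructure≡ rc
  where
  open RotatingRealisation
  realise : ∀ {v d} → v ∈ CS n (suc d) → RotatingRealisation v (suc d)
  realise {v} v∈ = rotatingRealisation v (proj₁ (∈-CS⁻ v∈)) (proj₂ (∈-CS⁻ v∈))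
  ra = realise a∈
  rb = realise b∈
  rc = realise c∈
  divisibility = inLCM⇒∣lcm {suc i} {suc j} {suc k} h
  open OrbitSquare (d≤n ra) (d≤n rb) (d≤n rc) (proj₁ divisibility)
                   (proj₁ (proj₂ divisibility)) (proj₂ (proj₂ divisibility))

All-candidates : ∀ n → All InCSAutotopismsPLS (candidates n)
All-candidates n =
  All-concatMap⁺ _ (range1 n) λ i∈ →
  All-concatMap⁺ _ (range1 n) λ j∈ →
  All-concatMap⁺ _ (range1 n) λ k∈ →
  realisable i∈ j∈ k∈
  where
  realisable : ∀ {i j k} → i ∈ range1 n → j ∈ range1 n → k ∈ range1 n →
               All InCSAutotopismsPLS (lcmTriples n i j k)
  realisable i∈ j∈ k∈ with ∈-map⁻ suc i∈ | ∈-map⁻ suc j∈ | ∈-map⁻ suc k∈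
  ... | _ , _ , refl | _ , _ , refl | _ , _ , refl = All-lcmTriples⁺ lcmTriple-realisable

proposition5 : (n : ℕ) → 1 ≤ n → CardCSAutotopismsPLS≥ n (lcmSum n)
proposition5 n _ =
  candidates n , Unique-candidates n , All-candidates n , ≤-reflexive (sym (length-candidates n))
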